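{- Let $(A,\le)$ be a poset with a monotone binary operation $+$, and let $(\bullet,i)$ be a commutative pomonoid on $(A,\le)$ such that $(x+y)\bullet z\le(x\bullet z)+(y\bullet z)$ for all $x,y,z$. Then $F\,\bar\bullet\, G=\alpha(F\hat\bullet G)$ and $\bar i=\alpha(\eta(i))$ define a residuated commutative pomonoid on $(\mathcal C(A),\subseteq)$. Moreover, $\eta^+(x\bullet y)=\eta^+(x)\,\bar\bullet\,\eta^+(y)$ for all $x,y\in A$.
   Context: A pomonoid is a monoid on a poset whose operation is monotone; commutative if the operation is commutative; a commutative pomonoid $(\star,e)$ is residuated if there is $\multimap$ with $x\star y\le z$ iff $x\le y\multimap z$. $\mathcal L(A)$: down-closed subsets; $\eta(x)=\{y\mid y\le x\}$; $F\hat\bullet G=\{z\mid z\le x\bullet y,\ x\in F,y\in G\}$. $\mathcal C(A)$: lower sets $F$ with $x,y\in F\Rightarrow x+y\in F$, ordered by inclusion. $\alpha(F)=\{x\mid x\le s\text{ for some finite }+\text{ -combination } s \text{ (arbitrary binary bracketing) of elements of } F\}$; $\eta^+(x)=\alpha(\eta(x))$. -}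

module Defs where

open import Level using (Level; _⊔_; suc; Lift; lift)
open import Data.Product using (Σ; ∃; _×_; _,_; proj₁; proj₂)
open import Algebra.Core using (Op₂)
open import Relation.Unary using (Pred; _⊆_)
open import Relation.Binary.Core using (Rel)
open import Relation.Binary.Bundles using (Poset)
open import Relation.Binary.Structures using (IsPartialOrder; IsPreorder; IsEquivalence)
open import Relation.Binary.Definitions using (Monotonic₂)

record IsCommPomonoid {c ℓ₁ ℓ₂} (P : Poset c ℓ₁ ℓ₂)
                      (_∙_ : Op₂ (Poset.Carrier P)) (e : Poset.Carrier P)
                      : Set (c ⊔ ℓ₁ ⊔ ℓ₂) where
  open Poset P
  field
    monotone  : Monotonic₂ _≤_ _≤_ _≤_ _∙_
    assoc     : ∀ x y z → ((x ∙ y) ∙ z) ≈ (x ∙ (y ∙ z))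
    identityˡ : ∀ x → (e ∙ x) ≈ x
    identityʳ : ∀ x → (x ∙ e) ≈ x
    comm      : ∀ x y → (x ∙ y) ≈ (y ∙ x)

record IsResiduatedCommPomonoid {c ℓ₁ ℓ₂} (P : Poset c ℓ₁ ℓ₂)
                      (_∙_ : Op₂ (Poset.Carrier P)) (e : Poset.Carrier P)
                      : Set (c ⊔ ℓ₁ ⊔ ℓ₂) where
  open Poset P
  field
    isCommPomonoid : IsCommPomonoid P _∙_ e
    _⊸_            : Op₂ Carrier
    residual→      : ∀ x y z → (x ∙ y) ≤ z → x ≤ (y ⊸ z)
    residual←      : ∀ x y z → x ≤ (y ⊸ z) → (x ∙ y) ≤ z

module _ {c ℓ₁ ℓ₂} (P : Poset c ℓ₁ ℓ₂) where
  open Poset P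

  SubLevel : Level
  SubLevel = c ⊔ ℓ₂

  IsLower : Pred Carrier SubLevel → Set SubLevel
  IsLower F = ∀ {x y} → y ≤ x → F x → F y

  η : Carrier → Pred Carrier SubLevel
  η x y = Lift c (y ≤ x)

  lift₂ : Op₂ Carrier → Pred Carrier SubLevel → Pred Carrier SubLevel → Pred Carrier SubLevel
  lift₂ _∙_ F G z = Σ Carrier λ x → Σ Carrier λ y → F x × G y × z ≤ (x ∙ y)

-- finite +-combinations with arbitrary binary bracketing
data Tm {c} (A : Set c) : Set c where
  leaf : A → Tm A
  node : Tm A → Tm A → Tm A

eval : ∀ {c} {A : Set c} → Op₂ A → Tm A → A
eval _+_ (leaf x)   = x
eval _+_ (node s t) = eval _+_ s + eval _+_ t

LeavesIn : ∀ {c p} {A : Set c} → Pred A p → Tm A → Set p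
LeavesIn F (leaf x)   = F x
LeavesIn F (node s t) = LeavesIn F s × LeavesIn F t

module _ {c ℓ₁ ℓ₂} (P : Poset c ℓ₁ ℓ₂) (_+_ : Op₂ (Poset.Carrier P)) where
  open Poset P

  IsPlusClosed : Pred Carrier (SubLevel P) → Set (SubLevel P)
  IsPlusClosed F = ∀ {x y} → F x → F y → F (x + y)

  CA : Set (c ⊔ suc (SubLevel P))
  CA = Σ (Pred Carrier (SubLevel P)) λ F → IsLower P F × IsPlusClosed F

  _⊑_ : Rel CA (SubLevel P)
  F ⊑ G = proj₁ F ⊆ proj₁ G

  _≋_ : Rel CA (SubLevel P)
  F ≋ G = (F ⊑ G) × (G ⊑ F)

  C-poset : Poset (c ⊔ suc (SubLevel P)) (SubLevel P) (SubLevel P)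
  C-poset = record
    { Carrier = CA
    ; _≈_ = _≋_
    ; _≤_ = _⊑_
    ; isPartialOrder = record
      { isPreorder = record
        { isEquivalence = record
          { refl  = (λ z → z) , (λ z → z)
          ; sym   = λ { (p , q) → q , p }
          ; trans = λ { (p , q) (p′ , q′) → (λ z → p′ (p z)) , (λ z → q (q′ z)) }
          }
        ; reflexive = proj₁
        ; trans = λ p q z → q (p z)
        }
      ; antisym = _,_
      }
    }

  α : Pred Carrier (SubLevel P) → Pred Carrier (SubLevel P)
  α F x = Σ (Tm Carrier) λ t → LeavesIn F t × x ≤ eval _+_ t

module _ {c ℓ₁ ℓ₂} (P : Poset c ℓ₁ ℓ₂) (_+_ : Op₂ (Poset.Carrier P))
         (+-mono : Monotonic₂ (Poset._≤_ P) (Poset._≤_ P) (Poset._≤_ P) _+_) where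
  open Poset P

  α-lower : ∀ F → IsLower P (α P _+_ F)
  α-lower F y≤x (t , lv , x≤t) = t , lv , trans y≤x x≤t

  α-closed : ∀ F → IsPlusClosed P _+_ (α P _+_ F)
  α-closed F (s , ls , x≤s) (t , lt , y≤t) = node s t , (ls , lt) , +-mono x≤s y≤t

  αC : Pred Carrier (SubLevel P) → CA P _+_
  αC F = α P _+_ F , α-lower F , α-closed F

  η⁺ : Carrier → CA P _+_
  η⁺ x = αC (η P x)

  bar : Op₂ Carrier → Op₂ (CA P _+_)
  bar _∙_ F G = αC (lift₂ P _∙_ (proj₁ F) (proj₁ G))

  barUnit : Carrier → CA P _+_
  barUnit i = αC (η P i)

module Submission where

open import Level using (lift)
open import Data.Product using (_×_; _,_; proj₁; proj₂)
open import Algebra.Core using (Op₂)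
open import Function using (id; _∘_)
open import Relation.Binary.Bundles using (Poset)
open import Relation.Binary.Definitions using (Monotonic₂)
open import Relation.Unary using (Pred; _⊆_)
open import Defs

-- α is a closure operator on subsets whose closed sets are exactly C(A). The
-- law (x + y) ∙ z ≤ x ∙ z + y ∙ z pushes ∙ through finite sums, which gives
-- α (α F ^∙ α G) = α (F ^∙ G); hence ∙̄ inherits associativity, commutativity,
-- the unit and the behaviour on principal ideals from ^∙, and thus from ∙.
-- The residual is F ⊸ G = { x | x ∙ y ∈ G for all y ∈ F }, +-closed by the
-- same law.

module _ {c ℓ₁ ℓ₂} (P : Poset c ℓ₁ ℓ₂) where
  open Poset P

  Subset : Set _
  Subset = Pred Carrier (SubLevel P)

  module Closure (_+_ : Op₂ Carrier) (+-mono : Monotonic₂ _≤_ _≤_ _≤_ _+_) where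

    LeavesIn-mono : ∀ {S T : Subset} → S ⊆ T → ∀ t → LeavesIn S t → LeavesIn T t
    LeavesIn-mono S⊆T (leaf x)   Sx        = S⊆T Sx
    LeavesIn-mono S⊆T (node s t) (ls , lt) = LeavesIn-mono S⊆T s ls , LeavesIn-mono S⊆T t lt

    α-mono : ∀ {S T : Subset} → S ⊆ T → α P _+_ S ⊆ α P _+_ T
    α-mono S⊆T (t , lt , x≤t) = t , LeavesIn-mono S⊆T t lt , x≤t

    α-extensive : ∀ {S : Subset} → S ⊆ α P _+_ S
    α-extensive {x = x} Sx = leaf x , Sx , refl

    eval-closed : ∀ (G : CA P _+_) t → LeavesIn (proj₁ G) t → proj₁ G (eval _+_ t)
    eval-closed G (leaf x)   Gx        = Gx
    eval-closed G (node s t) (ls , lt) = proj₂ (proj₂ G) (eval-closed G s ls) (eval-closed G t lt)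

    α-least : ∀ {S : Subset} (G : CA P _+_) → S ⊆ proj₁ G → α P _+_ S ⊆ proj₁ G
    α-least G S⊆G (t , lt , x≤t) = proj₁ (proj₂ G) x≤t (eval-closed G t (LeavesIn-mono S⊆G t lt))

    α-idempotent : ∀ {S : Subset} → α P _+_ (α P _+_ S) ⊆ α P _+_ S
    α-idempotent {S} = α-least (αC P _+_ +-mono S) id

  module Products (_∙_ : Op₂ Carrier) where

    _⊙_ : Subset → Subset → Subset
    _⊙_ = lift₂ P _∙_

    lift₂-mono : ∀ {S S′ T T′ : Subset} → S ⊆ S′ → T ⊆ T′ → S ⊙ T ⊆ S′ ⊙ T′
    lift₂-mono S⊆S′ T⊆T′ (x , y , Sx , Ty , z≤) = x , y , S⊆S′ Sx , T⊆T′ Ty , z≤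

    η-⊆-lift₂-η : ∀ x y → η P (x ∙ y) ⊆ η P x ⊙ η P y
    η-⊆-lift₂-η x y (lift z≤) = x , y , lift refl , lift refl , z≤

    module _ {e : Carrier} (pm : IsCommPomonoid P _∙_ e) where
      open IsCommPomonoid pm

      lift₂-η-⊆-η : ∀ x y → η P x ⊙ η P y ⊆ η P (x ∙ y)
      lift₂-η-⊆-η x y (a , b , lift a≤x , lift b≤y , z≤) = lift (trans z≤ (monotone a≤x b≤y))

      lift₂-comm : ∀ {S T : Subset} → S ⊙ T ⊆ T ⊙ S
      lift₂-comm (x , y , Sx , Ty , z≤) = y , x , Ty , Sx , trans z≤ (reflexive (comm x y))

      lift₂-assocˡ : ∀ {S T U : Subset} → (S ⊙ T) ⊙ U ⊆ S ⊙ (T ⊙ U)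
      lift₂-assocˡ (w , u , (s , t , Ss , Tt , w≤) , Uu , z≤) =
        s , t ∙ u , Ss , (t , u , Tt , Uu , refl) ,
        trans z≤ (trans (monotone w≤ refl) (reflexive (assoc s t u)))

      lift₂-assocʳ : ∀ {S T U : Subset} → S ⊙ (T ⊙ U) ⊆ (S ⊙ T) ⊙ U
      lift₂-assocʳ (s , w , Ss , (t , u , Tt , Uu , w≤) , z≤) =
        s ∙ t , u , (s , t , Ss , Tt , refl) , Uu ,
        trans z≤ (trans (monotone refl w≤) (reflexive (Eq.sym (assoc s t u))))

      lift₂-identityˡ-⊆ : ∀ {S : Subset} → IsLower P S → η P e ⊙ S ⊆ S
      lift₂-identityˡ-⊆ S-lower (a , y , lift a≤e , Sy , z≤) =
        S-lower (trans z≤ (trans (monotone a≤e refl) (reflexive (identityˡ y)))) Sy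

      lift₂-identityˡ-⊇ : ∀ {S : Subset} → S ⊆ η P e ⊙ S
      lift₂-identityˡ-⊇ {x = y} Sy = e , y , lift refl , Sy , reflexive (Eq.sym (identityˡ y))

  module Distributive
      (_+_ : Op₂ Carrier) (+-mono : Monotonic₂ _≤_ _≤_ _≤_ _+_)
      (_∙_ : Op₂ Carrier) {e : Carrier} (pm : IsCommPomonoid P _∙_ e)
      (distrib : ∀ x y z → ((x + y) ∙ z) ≤ ((x ∙ z) + (y ∙ z))) where
    open IsCommPomonoid pm
    open Closure _+_ +-mono
    open Products _∙_

    eval-∙-∈-α : ∀ {S T : Subset} t {y} → LeavesIn S t → T y →
                 α P _+_ (S ⊙ T) (eval _+_ t ∙ y)
    eval-∙-∈-α (leaf x)   {y} Sx        Ty = α-extensive (x , y , Sx , Ty , refl)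
    eval-∙-∈-α (node s t) {y} (ls , lt) Ty =
      α-lower P _+_ +-mono _ (distrib (eval _+_ s) (eval _+_ t) y)
        (α-closed P _+_ +-mono _ (eval-∙-∈-α s ls Ty) (eval-∙-∈-α t lt Ty))

    lift₂-αˡ : ∀ {S T : Subset} → α P _+_ S ⊙ T ⊆ α P _+_ (S ⊙ T)
    lift₂-αˡ (x , y , (t , lt , x≤t) , Ty , z≤) =
      α-lower P _+_ +-mono _ (trans z≤ (monotone x≤t refl)) (eval-∙-∈-α t lt Ty)

    lift₂-αʳ : ∀ {S T : Subset} → S ⊙ α P _+_ T ⊆ α P _+_ (S ⊙ T)
    lift₂-αʳ = α-mono (lift₂-comm pm) ∘ lift₂-αˡ ∘ lift₂-comm pm

    α-lift₂-α : ∀ {S T : Subset} → α P _+_ (α P _+_ S ⊙ α P _+_ T) ⊆ α P _+_ (S ⊙ T)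
    α-lift₂-α = α-idempotent ∘ α-mono lift₂-αʳ ∘ α-idempotent ∘ α-mono lift₂-αˡ

    _⊸_ : CA P _+_ → CA P _+_ → CA P _+_
    F ⊸ G = (λ x → ∀ y → proj₁ F y → proj₁ G (x ∙ y))
          , (λ x′≤x Fx y Fy → proj₁ (proj₂ G) (monotone x′≤x refl) (Fx y Fy))
          , (λ Fx Fx′ y Fy → proj₁ (proj₂ G) (distrib _ _ y)
                                 (proj₂ (proj₂ G) (Fx y Fy) (Fx′ y Fy)))

  module Quantale
      (_+_ : Op₂ Carrier) (+-mono : Monotonic₂ _≤_ _≤_ _≤_ _+_)
      (_∙_ : Op₂ Carrier) (e : Carrier) (pm : IsCommPomonoid P _∙_ e)
      (distrib : ∀ x y z → ((x + y) ∙ z) ≤ ((x ∙ z) + (y ∙ z))) where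
    open Closure _+_ +-mono
    open Products _∙_
    open Distributive _+_ +-mono _∙_ pm distrib

    _∙̄_ : Op₂ (CA P _+_)
    _∙̄_ = bar P _+_ +-mono _∙_

    ī : CA P _+_
    ī = barUnit P _+_ +-mono e

    _≋C_ : CA P _+_ → CA P _+_ → Set (SubLevel P)
    _≋C_ = _≋_ P _+_

    ∙̄-comm : ∀ F G → (F ∙̄ G) ≋C (G ∙̄ F)
    ∙̄-comm F G = α-mono (lift₂-comm pm) , α-mono (lift₂-comm pm)

    ∙̄-assoc : ∀ F G H → ((F ∙̄ G) ∙̄ H) ≋C (F ∙̄ (G ∙̄ H))
    ∙̄-assoc F G H =
        α-mono (lift₂-mono id α-extensive) ∘ α-mono (lift₂-assocˡ pm)
          ∘ α-lift₂-α ∘ α-mono (lift₂-mono id α-extensive)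
      , α-mono (lift₂-mono α-extensive id) ∘ α-mono (lift₂-assocʳ pm)
          ∘ α-lift₂-α ∘ α-mono (lift₂-mono α-extensive id)

    ∙̄-identityˡ : ∀ F → (ī ∙̄ F) ≋C F
    ∙̄-identityˡ F =
        α-least F (lift₂-identityˡ-⊆ pm (proj₁ (proj₂ F)))
          ∘ α-lift₂-α ∘ α-mono (lift₂-mono id α-extensive)
      , α-extensive ∘ lift₂-mono α-extensive id ∘ lift₂-identityˡ-⊇ pm

    ∙̄-identityʳ : ∀ F → (F ∙̄ ī) ≋C F
    ∙̄-identityʳ F = proj₁ (∙̄-identityˡ F) ∘ proj₁ (∙̄-comm F ī)
                  , proj₂ (∙̄-comm F ī) ∘ proj₂ (∙̄-identityˡ F)

    isResiduatedCommPomonoid : IsResiduatedCommPomonoid (C-poset P _+_) _∙̄_ ī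
    isResiduatedCommPomonoid = record
      { isCommPomonoid = record
        { monotone  = λ F⊑F′ G⊑G′ → α-mono (lift₂-mono F⊑F′ G⊑G′)
        ; assoc     = ∙̄-assoc
        ; identityˡ = ∙̄-identityˡ
        ; identityʳ = ∙̄-identityʳ
        ; comm      = ∙̄-comm
        }
      ; _⊸_       = _⊸_
      ; residual→ = λ H F G H∙̄F⊑G Hx y Fy → H∙̄F⊑G (α-extensive (_ , y , Hx , Fy , refl))
      ; residual← = λ H F G H⊑F⊸G → α-least G λ (x , y , Hx , Fy , z≤) →
                      proj₁ (proj₂ G) z≤ (H⊑F⊸G Hx y Fy)
      }

    η⁺-homomorphic : ∀ x y → η⁺ P _+_ +-mono (x ∙ y) ≋C (η⁺ P _+_ +-mono x ∙̄ η⁺ P _+_ +-mono y)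
    η⁺-homomorphic x y = α-mono (lift₂-mono α-extensive α-extensive ∘ η-⊆-lift₂-η x y)
                       , α-mono (lift₂-η-⊆-η pm x y) ∘ α-lift₂-α

proposition3p32 :
    ∀ {c ℓ₁ ℓ₂} (P : Poset c ℓ₁ ℓ₂)
      (_+_ : Op₂ (Poset.Carrier P))
      (+-mono : Monotonic₂ (Poset._≤_ P) (Poset._≤_ P) (Poset._≤_ P) _+_)
      (_∙_ : Op₂ (Poset.Carrier P)) (i : Poset.Carrier P) →
    IsCommPomonoid P _∙_ i →
    (∀ x y z → Poset._≤_ P ((x + y) ∙ z) ((x ∙ z) + (y ∙ z))) →
    IsResiduatedCommPomonoid (C-poset P _+_) (bar P _+_ +-mono _∙_) (barUnit P _+_ +-mono i)
    × (∀ x y → Poset._≈_ (C-poset P _+_)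
                 (η⁺ P _+_ +-mono (x ∙ y))
                 (bar P _+_ +-mono _∙_ (η⁺ P _+_ +-mono x) (η⁺ P _+_ +-mono y)))
proposition3p32 P _+_ +-mono _∙_ i pm distrib =
  isResiduatedCommPomonoid , η⁺-homomorphic
  where open Quantale P _+_ +-mono _∙_ i pm distrib
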